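{- Let $G$ be a maximal contraction graph with perfect matching $M=\{a_1b_1,\ldots,a_nb_n\}$. Then $G$ contains no cycle of the form $a_{i_1}b_{i_1}a_{i_2}b_{i_2}\ldots a_{i_k}b_{i_k}a_{i_1}$ with distinct indices $i_1,\ldots,i_k\in[n]$ and $2\le k\le n$ (an alternating cycle).
   Context: Let $G$ be a connected bipartite graph with bipartition $(A,B)$ and perfect matching $M=\{a_1b_1,\ldots,a_nb_n\}$ ($a_i\in A$, $b_i\in B$). A special subset is a set $\{a_{i_1},b_{i_1},\ldots,a_{i_k},b_{i_k}\}$ with distinct indices and $2\le k\le n$; it is a special elementary subset if the subgraph it induces is elementary, where a graph is elementary if it is connected and every edge lies in some perfect matching of it. $G$ is a maximal contraction graph if it has no special elementary subset (with respect to $M$). -}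

module Defs where

open import Data.Nat using (ℕ; zero; suc; _≤_)
open import Data.Fin using (Fin; zero; suc; inject₁; fromℕ)
open import Data.Fin.Subset using (Subset; _∈_; _∉_; ∣_∣)
open import Data.Fin.Permutation using (Permutation′; _⟨$⟩ʳ_)
open import Data.Sum using (_⊎_; inj₁; inj₂)
open import Data.Product using (Σ; ∃; _×_; _,_)
open import Data.Empty using (⊥)
open import Data.Unit using (⊤)
open import Relation.Nullary using (¬_)
open import Relation.Binary.PropositionalEquality using (_≡_)
open import Function.Definitions using (Injective)

-- A bipartite graph on vertex classes A = {a_0..a_{n-1}} and B = {b_0..b_{n-1}}
-- is given by its edge relation E i j  meaning  a_i b_j is an edge.
BipGraph : ℕ → Set₁
BipGraph n = Fin n → Fin n → Set

-- M = {a_i b_i} is a perfect matching of G.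
HasDiagonalMatching : ∀ {n} → BipGraph n → Set
HasDiagonalMatching {n} E = (i : Fin n) → E i i

-- Vertices: inj₁ i = a_i, inj₂ j = b_j.
Vertex : ℕ → Set
Vertex n = Fin n ⊎ Fin n

Adj : ∀ {n} → BipGraph n → Vertex n → Vertex n → Set
Adj E (inj₁ i) (inj₁ j) = ⊥
Adj E (inj₁ i) (inj₂ j) = E i j
Adj E (inj₂ i) (inj₁ j) = E j i
Adj E (inj₂ i) (inj₂ j) = ⊥

index : ∀ {n} → Vertex n → Fin n
index (inj₁ i) = i
index (inj₂ i) = i

data Reach {n} (E : BipGraph n) (P : Vertex n → Set) : Vertex n → Vertex n → Set where
  here : ∀ {u} → P u → Reach E P u u
  step : ∀ {u w v} → P u → Adj E u w → Reach E P w v → Reach E P u v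

Connected : ∀ {n} → BipGraph n → Set
Connected {n} E = (u v : Vertex n) → Reach E (λ _ → ⊤) u v

InS : ∀ {n} → Subset n → Vertex n → Set
InS S v = index v ∈ S

-- A perfect matching of the subgraph induced by {a_i,b_i : i ∈ S}:
-- a permutation σ (identity outside S) with a_k b_{σ k} an edge for every k ∈ S.
IsPerfectMatchingOn : ∀ {n} → BipGraph n → Subset n → Permutation′ n → Set
IsPerfectMatchingOn {n} E S σ =
  ((k : Fin n) → k ∉ S → σ ⟨$⟩ʳ k ≡ k) × ((k : Fin n) → k ∈ S → E k (σ ⟨$⟩ʳ k))

InducedElementary : ∀ {n} → BipGraph n → Subset n → Set
InducedElementary {n} E S =
  ((u v : Vertex n) → InS S u → InS S v → Reach E (InS S) u v)
  × ((i j : Fin n) → i ∈ S → j ∈ S → E i j →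
       Σ (Permutation′ n) λ σ → IsPerfectMatchingOn E S σ × (σ ⟨$⟩ʳ i ≡ j))

SpecialElementary : ∀ {n} → BipGraph n → Subset n → Set
SpecialElementary E S = (2 ≤ ∣ S ∣) × InducedElementary E S

MaximalContraction : ∀ {n} → BipGraph n → Set
MaximalContraction {n} E =
  Connected E × HasDiagonalMatching E × ((S : Subset n) → ¬ SpecialElementary E S)

-- An alternating cycle a_{i_1} b_{i_1} a_{i_2} b_{i_2} ... a_{i_k} b_{i_k} a_{i_1},
-- k = suc m ≥ 2, indices given by an injective f : Fin k → Fin n.
-- Edges b_{i_t} a_{i_{t+1}} and b_{i_k} a_{i_1}  (a_i b_i edges are in M).
AlternatingCycle : ∀ {n} → BipGraph n → Set
AlternatingCycle {n} E =
  Σ ℕ λ m → (1 ≤ m) × Σ (Fin (suc m) → Fin n) λ f →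
    Injective _≡_ _≡_ f
    × ((t : Fin m) → E (f (suc t)) (f (inject₁ t)))
    × E (f zero) (f (fromℕ m))

{-# OPTIONS --safe #-}
-- The index set S of an alternating cycle C is itself a special elementary subset.  The
-- subgraph induced by S is connected along C.  For an edge a_i b_j inside S, rotate C so that
-- it starts at i; the segment of C from a_i to b_j together with the chord b_j a_i is a
-- shorter alternating cycle (of length 1 if i = j), and switching M along it gives a perfect
-- matching of S that contains a_i b_j.
module Submission where

open import Defs
open import Data.Nat using (ℕ; suc; _≤_; _<_; s≤s)
open import Data.Nat.Properties using (≤-trans)
open import Data.Fin using (Fin; zero; suc; toℕ; fromℕ; inject₁; inject≤; punchIn)
open import Data.Fin.Properties
  using (_≟_; any?; toℕ-injective; toℕ-inject≤; toℕ-inject₁; toℕ-fromℕ; toℕ<n; inject≤-injective)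
open import Data.Fin.Induction using (<-weakInduction; >-weakInduction)
open import Data.Fin.Subset using (Subset; _∈_; _∉_; ∣_∣)
open import Data.Fin.Subset.Properties
  using (p⊆q⇒∣p∣≤∣q∣; ∣⁅x⁆∣≡1; x∈⁅y⁆⇒x≡y; x∈p⇒∣p-x∣<∣p∣; x∈p∧x≢y⇒x∈p-y)
open import Data.Fin.Permutation
  using (Permutation′; _⟨$⟩ʳ_; _⟨$⟩ˡ_; permutation; inverseˡ; inverseʳ; insert; id; _∘ₚ_)
open import Data.Vec using (tabulate; lookup)
open import Data.Vec.Properties using (lookup∘tabulate; []=⇒lookup; lookup⇒[]=)
open import Data.Sum using (_⊎_; inj₁; inj₂; [_,_]′)
open import Data.Product using (Σ; ∃; _×_; _,_)
open import Data.Unit using (tt)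
open import Data.Bool using (T)
open import Relation.Nullary using (¬_; yes; no; does; contradiction)
open import Relation.Nullary.Decidable using (dec-true; isYes; isYes≗does; toWitness)
open import Relation.Binary.PropositionalEquality
  using (_≡_; _≢_; refl; sym; trans; cong; subst; subst₂; module ≡-Reasoning)
open import Function using (_∘_)
open import Function.Definitions using (Injective)

reach-trans : ∀ {n} {E : BipGraph n} {P} {u v w} → Reach E P u v → Reach E P v w → Reach E P u w
reach-trans (here _) q = q
reach-trans (step p a r) q = step p a (reach-trans r q)

x∈p⇒0<∣p∣ : ∀ {n} {p : Subset n} {x} → x ∈ p → 0 < ∣ p ∣
x∈p⇒0<∣p∣ {p = p} {x} x∈p =
  subst (_≤ ∣ p ∣) (∣⁅x⁆∣≡1 x) (p⊆q⇒∣p∣≤∣q∣ λ y∈⁅x⁆ → subst (_∈ p) (sym (x∈⁅y⁆⇒x≡y x y∈⁅x⁆)) x∈p)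

x∈p∧y∈p∧x≢y⇒1<∣p∣ : ∀ {n} {p : Subset n} {x y} → x ∈ p → y ∈ p → x ≢ y → 1 < ∣ p ∣
x∈p∧y∈p∧x≢y⇒1<∣p∣ x∈p y∈p x≢y =
  ≤-trans (s≤s (x∈p⇒0<∣p∣ (x∈p∧x≢y⇒x∈p-y y∈p (x≢y ∘ sym)))) (x∈p⇒∣p-x∣<∣p∣ x∈p)

module _ {k n} (f : Fin k → Fin n) where

  image : Subset n
  image = tabulate λ x → does (any? λ i → f i ≟ x)

  image-complete : ∀ i → f i ∈ image
  image-complete i = lookup⇒[]= (f i) image
    (trans (lookup∘tabulate _ (f i)) (dec-true (any? λ j → f j ≟ f i) (i , refl)))

  image-sound : ∀ {x} → x ∈ image → ∃ λ i → f i ≡ x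
  image-sound {x} x∈image =
    toWitness (subst T (trans (sym ([]=⇒lookup x∈image)) lookup≡isYes) tt)
    where
    lookup≡isYes : lookup image x ≡ isYes (any? λ i → f i ≟ x)
    lookup≡isYes = trans (lookup∘tabulate _ x) (sym (isYes≗does (any? λ i → f i ≟ x)))

  image-or-outside : ∀ x → (∃ λ i → f i ≡ x) ⊎ (∀ i → f i ≢ x)
  image-or-outside x with any? (λ i → f i ≟ x)
  ... | yes fi≡x = inj₁ fi≡x
  ... | no  ¬fi≡x = inj₂ λ i fi≡x → ¬fi≡x (i , fi≡x)

⟨$⟩ʳ-injective : ∀ {k} (ρ : Permutation′ k) → Injective _≡_ _≡_ (ρ ⟨$⟩ʳ_)
⟨$⟩ʳ-injective ρ {i} {j} ρi≡ρj = begin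
  i                    ≡⟨ inverseˡ ρ ⟨
  ρ ⟨$⟩ˡ (ρ ⟨$⟩ʳ i)   ≡⟨ cong (ρ ⟨$⟩ˡ_) ρi≡ρj ⟩
  ρ ⟨$⟩ˡ (ρ ⟨$⟩ʳ j)   ≡⟨ inverseˡ ρ ⟩
  j                    ∎
  where open ≡-Reasoning

module _ {k n} {g : Fin k → Fin n} (g-injective : Injective _≡_ _≡_ g) where

  private
    transport : (Fin k → Fin k) → Fin n → Fin n
    transport ρ x with image-or-outside g x
    ... | inj₁ (u , _) = g (ρ u)
    ... | inj₂ _       = x

    transport-image : ∀ ρ u → transport ρ (g u) ≡ g (ρ u)
    transport-image ρ u with image-or-outside g (g u)
    ... | inj₁ (v , gv≡gu) = cong (g ∘ ρ) (g-injective gv≡gu)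
    ... | inj₂ outside     = contradiction refl (outside u)

    transport-outside : ∀ ρ {x} → (∀ u → g u ≢ x) → transport ρ x ≡ x
    transport-outside ρ {x} outside with image-or-outside g x
    ... | inj₁ (u , gu≡x) = contradiction gu≡x (outside u)
    ... | inj₂ _          = refl

    transport-inverse : ∀ {ρ ρ′} → (∀ u → ρ (ρ′ u) ≡ u) → ∀ x → transport ρ (transport ρ′ x) ≡ x
    transport-inverse {ρ} {ρ′} ρρ′≡id x = [ in-image , outside-image ]′ (image-or-outside g x)
      where
      open ≡-Reasoning
      in-image : (∃ λ u → g u ≡ x) → transport ρ (transport ρ′ x) ≡ x
      in-image (u , refl) = begin
        transport ρ (transport ρ′ (g u))  ≡⟨ cong (transport ρ) (transport-image ρ′ u) ⟩
        transport ρ (g (ρ′ u))            ≡⟨ transport-image ρ (ρ′ u) ⟩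
        g (ρ (ρ′ u))                      ≡⟨ cong g (ρρ′≡id u) ⟩
        g u                               ∎
      outside-image : (∀ u → g u ≢ x) → transport ρ (transport ρ′ x) ≡ x
      outside-image outside =
        trans (cong (transport ρ) (transport-outside ρ′ outside)) (transport-outside ρ outside)

  extendAlong : Permutation′ k → Permutation′ n
  extendAlong ρ = permutation (transport (ρ ⟨$⟩ʳ_)) (transport (ρ ⟨$⟩ˡ_))
    (transport-inverse λ _ → inverseʳ ρ) (transport-inverse λ _ → inverseˡ ρ)

  extendAlong-image : ∀ ρ u → extendAlong ρ ⟨$⟩ʳ g u ≡ g (ρ ⟨$⟩ʳ u)
  extendAlong-image ρ = transport-image (ρ ⟨$⟩ʳ_)

  extendAlong-outside : ∀ ρ {x} → (∀ u → g u ≢ x) → extendAlong ρ ⟨$⟩ʳ x ≡ x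
  extendAlong-outside ρ = transport-outside (ρ ⟨$⟩ʳ_)

-- The cyclic predecessor on Fin (suc m): 0 ↦ m and i + 1 ↦ i.
prev : ∀ {m} → Permutation′ (suc m)
prev {m} = insert zero (fromℕ m) id

punchIn-fromℕ : ∀ {m} (t : Fin m) → punchIn (fromℕ m) t ≡ inject₁ t
punchIn-fromℕ zero    = refl
punchIn-fromℕ (suc t) = cong suc (punchIn-fromℕ t)

prev-suc : ∀ {m} (t : Fin m) → prev ⟨$⟩ʳ suc t ≡ inject₁ t
prev-suc = punchIn-fromℕ

-- The closed walk a_{f 0} b_{f 0} a_{f 1} … b_{f m} a_{f 0}: its non-matching edges are
-- b_{f (prev i)} a_{f i}.  Unlike AlternatingCycle, m = 0 (a single matching edge) is allowed.
record IsAlternatingCycle {n m} (E : BipGraph n) (f : Fin (suc m) → Fin n) : Set where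
  constructor alternatingCycle
  field
    injective : Injective _≡_ _≡_ f
    edge      : ∀ i → E (f i) (f (prev ⟨$⟩ʳ i))

CommutesWithPrev : ∀ {m} → Permutation′ (suc m) → Set
CommutesWithPrev ρ = ∀ i → ρ ⟨$⟩ʳ (prev ⟨$⟩ʳ i) ≡ prev ⟨$⟩ʳ (ρ ⟨$⟩ʳ i)

rotation : ∀ {m} (s : Fin (suc m)) →
  Σ (Permutation′ (suc m)) λ ρ → CommutesWithPrev ρ × ρ ⟨$⟩ʳ zero ≡ s
rotation = >-weakInduction _ (prev , (λ _ → refl) , refl) λ i (ρ , ρ-comm , ρ0≡suc-i) →
  ρ ∘ₚ prev , (λ j → cong (prev ⟨$⟩ʳ_) (ρ-comm j)) , trans (cong (prev ⟨$⟩ʳ_) ρ0≡suc-i) (prev-suc i)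

inject≤-fromℕ-toℕ : ∀ {m} (t : Fin (suc m)) .(le : suc (toℕ t) ≤ suc m) →
  inject≤ (fromℕ (toℕ t)) le ≡ t
inject≤-fromℕ-toℕ t le = toℕ-injective (trans (toℕ-inject≤ (fromℕ (toℕ t)) le) (toℕ-fromℕ (toℕ t)))

inject≤-inject₁ : ∀ {d m} (u : Fin d) .(le : suc d ≤ suc m) .(le′ : d ≤ m) →
  inject≤ (inject₁ u) le ≡ inject₁ (inject≤ u le′)
inject≤-inject₁ u le le′ = toℕ-injective (begin
  toℕ (inject≤ (inject₁ u) le)  ≡⟨ toℕ-inject≤ (inject₁ u) le ⟩
  toℕ (inject₁ u)               ≡⟨ toℕ-inject₁ u ⟩
  toℕ u                         ≡⟨ toℕ-inject≤ u le′ ⟨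
  toℕ (inject≤ u le′)           ≡⟨ toℕ-inject₁ (inject≤ u le′) ⟨
  toℕ (inject₁ (inject≤ u le′)) ∎)
  where open ≡-Reasoning

-- The alternating cycle a_{f 0} b_{f 0} … a_{f t} b_{f t} a_{f 0},
-- closed by the chord b_{f t} a_{f 0}.
prefix : ∀ {n m} → (Fin (suc m) → Fin n) → (t : Fin (suc m)) → Fin (suc (toℕ t)) → Fin n
prefix f t u = f (inject≤ u (toℕ<n t))

module _ {n} {E : BipGraph n} where

  isAlternatingCycle-∘ : ∀ {m} {f : Fin (suc m) → Fin n} → IsAlternatingCycle E f →
    (ρ : Permutation′ (suc m)) → CommutesWithPrev ρ → IsAlternatingCycle E (f ∘ (ρ ⟨$⟩ʳ_))
  isAlternatingCycle-∘ {f = f} (alternatingCycle f-injective edges) ρ ρ-comm =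
    alternatingCycle (⟨$⟩ʳ-injective ρ ∘ f-injective)
    λ i → subst (E (f (ρ ⟨$⟩ʳ i)) ∘ f) (sym (ρ-comm i)) (edges (ρ ⟨$⟩ʳ i))

  rotateTo : ∀ {m} {f : Fin (suc m) → Fin n} → IsAlternatingCycle E f → ∀ s →
    Σ (Permutation′ (suc m)) λ ρ → IsAlternatingCycle E (f ∘ (ρ ⟨$⟩ʳ_)) × ρ ⟨$⟩ʳ zero ≡ s
  rotateTo cycle s with rotation s
  ... | ρ , ρ-comm , ρ0≡s = ρ , isAlternatingCycle-∘ cycle ρ ρ-comm , ρ0≡s

  prefix-isAlternatingCycle : ∀ {m} {f : Fin (suc m) → Fin n} → IsAlternatingCycle E f →
    ∀ t → E (f zero) (f t) → IsAlternatingCycle E (prefix f t)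
  prefix-isAlternatingCycle {f = f} (alternatingCycle f-injective edges) t chord =
    alternatingCycle (λ eq → inject≤-injective _ _ _ _ (f-injective eq)) prefix-edges
    where
    prefix-edges : ∀ i → E (prefix f t i) (prefix f t (prev ⟨$⟩ʳ i))
    prefix-edges zero    = subst (E (f zero) ∘ f) (sym (inject≤-fromℕ-toℕ t (toℕ<n t))) chord
    prefix-edges (suc u) =
      subst (E (prefix f t (suc u)) ∘ f) prev-commutes (edges (suc (inject≤ u _)))
      where
      open ≡-Reasoning
      prev-commutes : prev ⟨$⟩ʳ suc (inject≤ u _) ≡ inject≤ (prev ⟨$⟩ʳ suc u) (toℕ<n t)
      prev-commutes = begin
        prev ⟨$⟩ʳ suc (inject≤ u _)  ≡⟨ prev-suc _ ⟩
        inject₁ (inject≤ u _)        ≡⟨ inject≤-inject₁ u _ _ ⟨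
        inject≤ (inject₁ u) _        ≡⟨ cong (λ j → inject≤ j (toℕ<n t)) (prev-suc u) ⟨
        inject≤ (prev ⟨$⟩ʳ suc u) _  ∎

module _ {n} {E : BipGraph n} (diag : HasDiagonalMatching E) where

  extendAlong-isPerfectMatchingOn : ∀ {k} {g : Fin k → Fin n} (g-injective : Injective _≡_ _≡_ g)
    {S : Subset n} → (∀ u → g u ∈ S) → (ρ : Permutation′ k) → (∀ u → E (g u) (g (ρ ⟨$⟩ʳ u))) →
    IsPerfectMatchingOn E S (extendAlong g-injective ρ)
  extendAlong-isPerfectMatchingOn {g = g} g-injective {S} g∈S ρ edges = fixes , matches
    where
    fixes : ∀ x → x ∉ S → extendAlong g-injective ρ ⟨$⟩ʳ x ≡ x
    fixes x x∉S = extendAlong-outside g-injective ρ λ u gu≡x → x∉S (subst (_∈ S) gu≡x (g∈S u))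

    matches : ∀ x → x ∈ S → E x (extendAlong g-injective ρ ⟨$⟩ʳ x)
    matches x _ = [ in-image , outside-image ]′ (image-or-outside g x)
      where
      in-image : (∃ λ u → g u ≡ x) → E x (extendAlong g-injective ρ ⟨$⟩ʳ x)
      in-image (u , refl) = subst (E (g u)) (sym (extendAlong-image g-injective ρ u)) (edges u)
      outside-image : (∀ u → g u ≢ x) → E x (extendAlong g-injective ρ ⟨$⟩ʳ x)
      outside-image outside = subst (E x) (sym (extendAlong-outside g-injective ρ outside)) (diag x)

  reach-around : ∀ {m} {f : Fin (suc m) → Fin n} {S : Subset n} → IsAlternatingCycle E f →
    (∀ i → f i ∈ S) → ∀ t → Reach E (InS S) (inj₁ (f zero)) (inj₁ (f t))
  reach-around {f = f} {S} (alternatingCycle _ edges) f∈S =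
    <-weakInduction (λ t → Reach E (InS S) (inj₁ (f zero)) (inj₁ (f t))) (here (f∈S zero)) λ i r →
      reach-trans r (step {w = inj₂ (f (inject₁ i))} (f∈S (inject₁ i)) (diag (f (inject₁ i)))
        (step (f∈S (inject₁ i)) (subst (E (f (suc i)) ∘ f) (prev-suc i) (edges (suc i)))
          (here (f∈S (suc i)))))

  chord-perfectMatching : ∀ {m} {f : Fin (suc m) → Fin n} {S : Subset n} → IsAlternatingCycle E f →
    (∀ i → f i ∈ S) → ∀ t → E (f zero) (f t) →
    Σ (Permutation′ n) λ σ → IsPerfectMatchingOn E S σ × σ ⟨$⟩ʳ f zero ≡ f t
  chord-perfectMatching {f = f} cycle f∈S t chord
    with alternatingCycle g-injective g-edges ← prefix-isAlternatingCycle cycle t chord =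
    extendAlong g-injective prev ,
    extendAlong-isPerfectMatchingOn g-injective (λ u → f∈S _) prev g-edges ,
    trans (extendAlong-image g-injective prev zero) (cong f (inject≤-fromℕ-toℕ t (toℕ<n t)))

  module _ {m} {f : Fin (suc m) → Fin n} (cycle : IsAlternatingCycle E f) where

    private
      S = image f

    reach-image : ∀ s t → Reach E (InS S) (inj₁ (f s)) (inj₁ (f t))
    reach-image s t with rotateTo cycle s
    ... | ρ , cycle′ , ρ0≡s =
      subst₂ (λ x y → Reach E (InS S) (inj₁ (f x)) (inj₁ (f y))) ρ0≡s (inverseʳ ρ)
        (reach-around cycle′ (image-complete f ∘ (ρ ⟨$⟩ʳ_)) (ρ ⟨$⟩ˡ t))

    image-connected : ∀ u v → InS S u → InS S v → Reach E (InS S) u v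
    image-connected u v u∈S v∈S with image-sound f u∈S | image-sound f v∈S
    ... | s , fs≡u | t , ft≡v =
      reach-trans (to-a u u∈S fs≡u) (reach-trans (reach-image s t) (from-a v v∈S ft≡v))
      where
      to-a : ∀ {x} u → InS S u → f x ≡ index u → Reach E (InS S) u (inj₁ (f x))
      to-a (inj₁ _) u∈S refl = here u∈S
      to-a (inj₂ _) u∈S refl = step u∈S (diag _) (here u∈S)
      from-a : ∀ {x} v → InS S v → f x ≡ index v → Reach E (InS S) (inj₁ (f x)) v
      from-a (inj₁ _) v∈S refl = here v∈S
      from-a (inj₂ _) v∈S refl = step v∈S (diag _) (here v∈S)

    image-edge-perfectMatching : ∀ i j → i ∈ S → j ∈ S → E i j →
      Σ (Permutation′ n) λ σ → IsPerfectMatchingOn E S σ × σ ⟨$⟩ʳ i ≡ j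
    image-edge-perfectMatching i j i∈S j∈S eij with image-sound f i∈S | image-sound f j∈S
    ... | s , refl | t , refl with rotateTo cycle s
    ... | ρ , cycle′ , refl =
      subst (λ y → Σ (Permutation′ n) λ σ → IsPerfectMatchingOn E S σ × σ ⟨$⟩ʳ f (ρ ⟨$⟩ʳ zero) ≡ f y)
        (inverseʳ ρ)
        (chord-perfectMatching cycle′ (image-complete f ∘ (ρ ⟨$⟩ʳ_)) (ρ ⟨$⟩ˡ t)
          (subst (E (f (ρ ⟨$⟩ʳ zero)) ∘ f) (sym (inverseʳ ρ)) eij))

    image-inducedElementary : InducedElementary E S
    image-inducedElementary = image-connected , image-edge-perfectMatching

proposition17 : (n : ℕ) (E : BipGraph n) → MaximalContraction E → ¬ AlternatingCycle E
proposition17 n E (_ , diag , noSpecialElementary) (suc m , _ , f , f-injective , edges , closing) =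
  noSpecialElementary (image f) (two-indices , image-inducedElementary diag cycle)
  where
  edge : ∀ i → E (f i) (f (prev ⟨$⟩ʳ i))
  edge zero    = closing
  edge (suc t) = subst (E (f (suc t)) ∘ f) (sym (prev-suc t)) (edges t)

  cycle : IsAlternatingCycle E f
  cycle = alternatingCycle f-injective edge

  two-indices : 2 ≤ ∣ image f ∣
  two-indices =
    x∈p∧y∈p∧x≢y⇒1<∣p∣ (image-complete f zero) (image-complete f (suc zero)) ((λ ()) ∘ f-injective)
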